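{- Let $d,k\geq 1$ and $\epsilon\geq 0$ be integers. If there exists a $(d,k,+\epsilon)$-digraph, then for any integer $0\leq r\leq d$ there also exists a non-diregular $(d,k,+(\epsilon+1))$-digraph with minimum in-degree at most $d-r$.
   Context: A digraph is $k$-geodetic if for any two vertices $u,v$ there is at most one directed walk from $u$ to $v$ of length at most $k$. With $M(d,k)=1+d+\dots+d^k$, a $(d,k,+\epsilon)$-digraph is a $k$-geodetic digraph with minimum out-degree at least $d$ and order $M(d,k)+\epsilon$. A digraph is diregular if there is $c$ with $d^-(u)=d^+(u)=c$ for all vertices $u$. -}

module Defs where

open import Data.Nat using (ℕ; zero; suc; _+_; _*_; _^_; _≤_; _∸_)
open import Data.Fin using (Fin)
open import Data.Bool using (Bool; true; false; T)
open import Data.List using (List; sum; map; upTo; filter; length)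
open import Data.Vec.Functional using (Vector)
open import Data.Fin.Subset using (Subset; ∣_∣)
open import Data.Vec using (tabulate)
open import Data.Product using (Σ; _×_; _,_; ∃-syntax)
open import Relation.Binary.PropositionalEquality using (_≡_)

record Digraph (n : ℕ) : Set where
  field
    adj : Fin n → Fin n → Bool

open Digraph public

outdeg : ∀ {n} → Digraph n → Fin n → ℕ
outdeg G u = ∣ tabulate (λ v → adj G u v) ∣

indeg : ∀ {n} → Digraph n → Fin n → ℕ
indeg G v = ∣ tabulate (λ u → adj G u v) ∣

data Walk {n : ℕ} (G : Digraph n) : Fin n → Fin n → ℕ → Set where
  [] : ∀ {u} → Walk G u u 0
  _∷_ : ∀ {u w v ℓ} → T (adj G u w) → Walk G w v ℓ → Walk G u v (suc ℓ)

-- k-geodetic: for all u, v, at most one walk from u to v of length at most k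
-- (two such walks are equal, including their lengths).
KGeodetic : ∀ {n} → ℕ → Digraph n → Set
KGeodetic {n} k G =
  ∀ (u v : Fin n) (ℓ₁ ℓ₂ : ℕ) → ℓ₁ ≤ k → ℓ₂ ≤ k →
  (w₁ : Walk G u v ℓ₁) (w₂ : Walk G u v ℓ₂) →
  _≡_ {A = Σ ℕ (Walk G u v)} (ℓ₁ , w₁) (ℓ₂ , w₂)

M : ℕ → ℕ → ℕ
M d zero = 1
M d (suc k) = M d k + d ^ suc k

MinOutDegGE : ∀ {n} → Digraph n → ℕ → Set
MinOutDegGE {n} G d = ∀ (u : Fin n) → d ≤ outdeg G u

MinInDegLE : ∀ {n} → Digraph n → ℕ → Set
MinInDegLE {n} G c = ∃[ u ] indeg G u ≤ c

IsDKEps : ∀ {n} → ℕ → ℕ → ℕ → Digraph n → Set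
IsDKEps {n} d k ε G = KGeodetic k G × MinOutDegGE G d × n ≡ M d k + ε

Diregular : ∀ {n} → Digraph n → Set
Diregular {n} G = ∃[ c ] (∀ (u : Fin n) → indeg G u ≡ c × outdeg G u ≡ c)

module Submission where

-- From a (d,k,+ε)-digraph G on n vertices we build a
-- (d,k,+(ε+1))-digraph by adding one new vertex s that "clones" the
-- out-neighbourhood of some vertex u₀ of G and receives no arcs at all.
--
--  * The map φ sending s to u₀ and fixing every old vertex is a digraph
--    homomorphism from the new digraph onto G which is injective on each
--    out-neighbourhood.  Such homomorphisms map walks injectively, hence
--    they reflect k-geodeticity.
--  * Out-degrees are preserved by φ, so the minimum out-degree is still ≥ d,
--    and the order grows by exactly one.
--  * The new vertex is a source: in-degree 0 ≤ d ∸ r, and since its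
--    out-degree is ≥ d ≥ 1 the new digraph cannot be diregular.

open import Defs
open import Data.Nat using (ℕ; _≤_; _∸_; _+_)
open import Data.Product using (Σ; _×_; ∃-syntax)
open import Relation.Nullary using (¬_)

open import Data.Nat using (zero; suc; z≤n; s≤s; _^_)
open import Data.Nat.Properties using (≤-trans; m≤m+n; +-assoc; +-comm)
open import Data.Fin using (Fin; fromℕ<) renaming (zero to fz; suc to fs)
open import Data.Bool using (Bool; true; false; T)
open import Data.Product using (_,_; proj₁)
open import Data.Vec using (tabulate)
open import Data.Fin.Subset using (∣_∣)
open import Relation.Binary.PropositionalEquality
  using (_≡_; refl; cong; sym; trans; subst; module ≡-Reasoning)

-- The Moore bound is positive, so every (d,k,+ε)-digraph has a vertex.
M-positive : ∀ d k → 1 ≤ M d k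
M-positive d zero    = s≤s z≤n
M-positive d (suc k) = ≤-trans (M-positive d k) (m≤m+n (M d k) (d ^ suc k))

-- Proofs of T b are unique, so a walk is determined by its vertex sequence.
T-irrelevant : ∀ {b} (x y : T b) → x ≡ y
T-irrelevant {true} _ _ = refl

∣empty∣≡0 : ∀ m → ∣ tabulate {n = m} (λ _ → false) ∣ ≡ 0
∣empty∣≡0 zero    = refl
∣empty∣≡0 (suc m) = ∣empty∣≡0 m

Σ-second : ∀ {A : Set} {B : A → Set} {a : A} {x y : B a} →
  _≡_ {A = Σ A B} (a , x) (a , y) → x ≡ y
Σ-second refl = refl

∷-injective : ∀ {n} {G : Digraph n} {p q x x' l}
  {e : T (adj G p x)} {e' : T (adj G p x')}
  {t : Walk G x q l} {t' : Walk G x' q l} →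
  _≡_ {A = Walk G p q (suc l)} (e ∷ t) (e' ∷ t') →
  _≡_ {A = Σ (Fin n) (λ y → Walk G y q l)} (x , t) (x' , t')
∷-injective refl = refl

record OutInjectiveHom {m n : ℕ} (H : Digraph m) (G : Digraph n) : Set where
  field
    φ        : Fin m → Fin n
    arc      : ∀ {a b} → T (adj H a b) → T (adj G (φ a) (φ b))
    injOnOut : ∀ {a b b'} → T (adj H a b) → T (adj H a b') →
               φ b ≡ φ b' → b ≡ b'

module _ {m n : ℕ} {H : Digraph m} {G : Digraph n}
         (h : OutInjectiveHom H G) where
  open OutInjectiveHom h

  mapWalk : ∀ {a b l} → Walk H a b l → Walk G (φ a) (φ b) l
  mapWalk []      = []
  mapWalk (e ∷ t) = arc e ∷ mapWalk t

  -- Walks with the same start are recovered from their images: at each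
  -- step the next vertex is determined by out-injectivity.
  mapWalk-injective : ∀ {a b l} (w₁ w₂ : Walk H a b l) →
    mapWalk w₁ ≡ mapWalk w₂ → w₁ ≡ w₂
  mapWalk-injective [] [] _ = refl
  mapWalk-injective (e ∷ t) (e' ∷ t') same
    with ∷-injective same
  ... | images with injOnOut e e' (cong proj₁ images)
  ... | refl with Σ-second images
  ... | tails with mapWalk-injective t t' tails | T-irrelevant e e'
  ... | refl | refl = refl

  -- Out-injective homomorphisms reflect k-geodeticity: two short walks in H
  -- between the same vertices map to two short walks in G, which coincide.
  reflect-geodetic : ∀ k → KGeodetic k G → KGeodetic k H
  reflect-geodetic k geoG u v l₁ l₂ l₁≤k l₂≤k w₁ w₂
    with geoG (φ u) (φ v) l₁ l₂ l₁≤k l₂≤k (mapWalk w₁) (mapWalk w₂)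
  ... | images with cong proj₁ images
  ... | refl with mapWalk-injective w₁ w₂ (Σ-second images)
  ... | refl = refl

source-not-diregular : ∀ {n} (G : Digraph n) (s : Fin n) →
  indeg G s ≡ 0 → 1 ≤ outdeg G s → ¬ Diregular G
source-not-diregular G s in0 out≥1 (c , degrees) with degrees s
... | in≡c , out≡c with trans (sym in≡c) in0
... | refl with subst (1 ≤_) out≡c out≥1
... | ()

-- The one-vertex extension of G by a new source (vertex fz) whose
-- out-neighbourhood copies that of u₀; old vertex a becomes fs a.
module Extension {n : ℕ} (G : Digraph n) (u₀ : Fin n) where

  collapse : Fin (suc n) → Fin n
  collapse fz     = u₀
  collapse (fs a) = a

  extAdj : Fin (suc n) → Fin (suc n) → Bool
  extAdj a fz     = false
  extAdj a (fs v) = adj G (collapse a) v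

  Ext : Digraph (suc n)
  Ext = record { adj = extAdj }

  collapse-hom : OutInjectiveHom Ext G
  collapse-hom = record
    { φ = collapse ; arc = λ {a b} → arc {a} {b}
    ; injOnOut = λ {a b b'} → injOnOut {a} {b} {b'} }
    where
    arc : ∀ {a b} → T (adj Ext a b) → T (adj G (collapse a) (collapse b))
    arc {b = fs v} e = e

    injOnOut : ∀ {a b b'} → T (adj Ext a b) → T (adj Ext a b') →
               collapse b ≡ collapse b' → b ≡ b'
    injOnOut {b = fs v} {fs v'} _ _ same = cong fs same

  outdeg-collapse : ∀ a → outdeg Ext a ≡ outdeg G (collapse a)
  outdeg-collapse a = refl

  indeg-new : indeg Ext fz ≡ 0
  indeg-new = ∣empty∣≡0 n

theorem11 : (d k ε : ℕ) → 1 ≤ d → 1 ≤ k →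
    (∃[ n ] Σ (Digraph n) (IsDKEps d k ε)) →
    ∀ (r : ℕ) → r ≤ d →
    ∃[ m ] Σ (Digraph m) (λ H → IsDKEps d k (ε + 1) H × ¬ Diregular H × MinInDegLE H (d ∸ r))
theorem11 d k ε d≥1 _ (n , G , geoG , outG , order) r _ =
  suc n , Ext , (geodetic , outExt , order') , notDiregular , (fz , minIn)
  where
  n≥1 : 1 ≤ n
  n≥1 = subst (1 ≤_) (sym order) (≤-trans (M-positive d k) (m≤m+n (M d k) ε))

  open Extension G (fromℕ< n≥1)

  geodetic : KGeodetic k Ext
  geodetic = reflect-geodetic collapse-hom k geoG

  outExt : MinOutDegGE Ext d
  outExt a = subst (d ≤_) (sym (outdeg-collapse a)) (outG (collapse a))

  order' : suc n ≡ M d k + (ε + 1)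
  order' = begin
    suc n             ≡⟨ +-comm 1 n ⟩
    n + 1             ≡⟨ cong (_+ 1) order ⟩
    M d k + ε + 1     ≡⟨ +-assoc (M d k) ε 1 ⟩
    M d k + (ε + 1)   ∎
    where open ≡-Reasoning

  notDiregular : ¬ Diregular Ext
  notDiregular = source-not-diregular Ext fz indeg-new (≤-trans d≥1 (outExt fz))

  minIn : indeg Ext fz ≤ d ∸ r
  minIn = subst (_≤ d ∸ r) (sym indeg-new) z≤n
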